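{- Let $\sigma(\tau)$ be a tame type which is either principal series or regular cuspidal, with $\mathcal P_\tau$, $J_{\mathrm{base}}$ and $\iota$ as below. For any $J\subseteq J'\subseteq\mathcal S$ such that $\iota(J),\iota(J')\in\mathcal P_\tau$, there is a chain $J=J_0\subsetneq J_1\subsetneq\cdots\subsetneq J_{|J'|-|J|}=J'$ such that $|J_i|=i+|J|$ and $\iota(J_i)\in\mathcal P_\tau$ for each $i$.
   Context: $k_v=\mathbb F_q$, $q=p^f$, $l_v$ its quadratic extension, $\mathcal S=\{0,\dots,f-1\}$ with indices cyclic mod $f$; $[\cdot]$ is the Teichmüller lift into $\mathcal O^\times$, $\mathcal O$ the ring of integers of a finite extension $E/\mathbb{Q}_p$ whose residue field contains an embedding of $l_v$. Principal series case: $\sigma(\tau)=\mathrm{Ind}_B^{\mathrm{GL}_2(k_v)}(\eta'\otimes\eta)$ for characters $\eta\ne\eta':k_v^\times\to\mathcal O^\times$; let $0<c<q-1$ with $\eta\eta'^{ -1}(x)=[x]^c$, $c=\sum c_jp^j$ ($0\le c_j\le p-1$); $\mathcal P_\tau$ is the set of $J\subseteq\mathcal S$ such that ($j\in J$, $j-1\notin J$) implies $c_j\ne p-1$ and ($j\notin J$, $j-1\in J$) implies $c_j\ne0$; $J_{\mathrm{base}}=\emptyset$. Cuspidal case: $\sigma(\tau)=\Theta(\psi)$, the cuspidal representation of $\mathrm{GL}_2(k_v)$ attached to $\psi:l_v^\times\to\mathcal O^\times$ not factoring through the norm; write $\psi=[x]^{(q+1)b+1+c}$ with $0\le b\le q-2$,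 $0\le c\le q-1$, $c=\sum c_ip^i$; for $J\subseteq\mathcal S$ let $J_0=J\triangle\{f-1\}$; $\mathcal P_\tau$ is the set of $J$ such that ($j\in J$, $j-1\notin J_0$) implies $c_j\ne p-1$ and ($j\notin J$, $j-1\in J_0$) implies $c_j\ne0$; regular means some $0<c_i<p-1$; in this case $J_{\mathrm{base}}=\{i,\dots,f-1\}$ for some $i\in\mathcal S$ chosen such that $J_{\mathrm{base}}\in\mathcal P_\tau$ and $J_{\mathrm{base}}^c\in\mathcal P_\tau$ (such $i$ exists for regular cuspidal types). In both cases $\iota(J):=J\triangle J_{\mathrm{base}}$. -}

module Defs where

open import Data.Nat using (ℕ; zero; suc; _+_; _∸_; _^_; _≤_; _<_; _≤ᵇ_; NonZero)
open import Data.Nat.DivMod using (_/_; _%_)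
open import Data.Nat.Properties using (m^n≢0)
open import Data.Nat.Primality using (Prime; prime⇒nonZero)
open import Data.Bool using (Bool; true; false; _xor_)
open import Data.Fin using (Fin; toℕ; fromℕ; inject₁)
import Data.Fin as F
open import Data.Fin.Subset using (Subset; _∈_; _∉_; _⊆_; _⊂_; ∣_∣; ∁; ⁅_⁆; ⊥)
open import Data.Vec using (zipWith; tabulate)
open import Data.Product using (_×_; Σ; ∃)
open import Relation.Binary.PropositionalEquality using (_≡_; _≢_)

-- Throughout, f = suc m (so f ≥ 1) and S = Fin f.

prev : ∀ {m} → Fin (suc m) → Fin (suc m)
prev {m} F.zero = fromℕ m
prev (F.suc j) = inject₁ j

_△_ : ∀ {n} → Subset n → Subset n → Subset n
A △ B = zipWith _xor_ A B

digit : (p : ℕ) → Prime p → ℕ → ℕ → ℕ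
digit p pp c j =
  _%_ (_/_ c (p ^ j) {{m^n≢0 p j {{prime⇒nonZero pp}}}}) p {{prime⇒nonZero pp}}

q : ℕ → ℕ → ℕ
q p m = p ^ suc m

top : ∀ m → Fin (suc m)
top m = fromℕ m

PS-P : (p : ℕ) → Prime p → (m c : ℕ) → Subset (suc m) → Set
PS-P p pp m c J = (j : Fin (suc m)) →
  ((j ∈ J) → (prev j ∉ J) → digit p pp c (toℕ j) ≢ p ∸ 1) ×
  ((j ∉ J) → (prev j ∈ J) → digit p pp c (toℕ j) ≢ 0)

Cusp-P : (p : ℕ) → Prime p → (m c : ℕ) → Subset (suc m) → Set
Cusp-P p pp m c J = (j : Fin (suc m)) →
  ((j ∈ J) → (prev j ∉ J₀) → digit p pp c (toℕ j) ≢ p ∸ 1) ×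
  ((j ∉ J) → (prev j ∈ J₀) → digit p pp c (toℕ j) ≢ 0)
  where J₀ = J △ ⁅ top m ⁆

Regular : (p : ℕ) → Prime p → (m c : ℕ) → Set
Regular p pp m c = Σ (Fin (suc m)) λ i →
  (0 < digit p pp c (toℕ i)) × (digit p pp c (toℕ i) < p ∸ 1)

upFrom : ∀ {m} → Fin (suc m) → Subset (suc m)
upFrom i = tabulate (λ j → toℕ i ≤ᵇ toℕ j)

-- A tame type which is principal series or regular cuspidal, recorded by
-- the data relevant for P_τ and J_base.
data TameType (p : ℕ) (pp : Prime p) (m : ℕ) : Set where
  -- σ(τ) = Ind(η' ⊗ η), η η'^{-1} = [x]^c, 0 < c < q - 1
  principal : (c : ℕ) → 0 < c → c < q p m ∸ 1 → TameType p pp m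
  -- σ(τ) = Θ(ψ), ψ = [x]^{(q+1)b+1+c}, 0 ≤ b ≤ q-2, 0 ≤ c ≤ q-1, regular,
  -- with J_base = {i,…,f-1} chosen so that J_base, J_base^c ∈ P_τ
  cuspidal : (b c : ℕ) → b ≤ q p m ∸ 2 → c ≤ q p m ∸ 1 →
    Regular p pp m c → (i : Fin (suc m)) →
    Cusp-P p pp m c (upFrom i) → Cusp-P p pp m c (∁ (upFrom i)) →
    TameType p pp m

Pτ : ∀ {p pp m} → TameType p pp m → Subset (suc m) → Set
Pτ {p} {pp} {m} (principal c _ _) J = PS-P p pp m c J
Pτ {p} {pp} {m} (cuspidal _ c _ _ _ _ _ _) J = Cusp-P p pp m c J

Jbase : ∀ {p pp m} → TameType p pp m → Subset (suc m)
Jbase (principal _ _ _) = ⊥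
Jbase (cuspidal _ _ _ _ _ i _ _) = upFrom i

ι : ∀ {p pp m} → TameType p pp m → Subset (suc m) → Subset (suc m)
ι τ J = J △ Jbase τ

record Chain {p pp m} (τ : TameType p pp m) (J J' : Subset (suc m)) : Set where
  field
    chain   : Fin (suc (∣ J' ∣ ∸ ∣ J ∣)) → Subset (suc m)
    start   : chain F.zero ≡ J
    end     : chain (fromℕ (∣ J' ∣ ∸ ∣ J ∣)) ≡ J'
    strict  : (i : Fin (∣ J' ∣ ∸ ∣ J ∣)) → chain (inject₁ i) ⊂ chain (F.suc i)
    card    : (i : Fin (suc (∣ J' ∣ ∸ ∣ J ∣))) → ∣ chain i ∣ ≡ toℕ i + ∣ J ∣
    inP     : (i : Fin (suc (∣ J' ∣ ∸ ∣ J ∣))) → Pτ τ (ι τ (chain i))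

{-# OPTIONS --safe #-}
module Submission where

-- Read a subset K ⊆ S as a 0/1 word around the cycle S.  Membership of ι(K) in P_τ is a
-- conjunction of conditions on the consecutive pairs (prev j, j): the digit c_j forbids at most
-- one of the two boundary patterns "K starts at j" and "K ends at prev j" (as p - 1 ≠ 0), and
-- neither pattern is forbidden at every j (0 < c < q - 1 for principal series, regularity for
-- cuspidal types).  Given such K ⊊ J, adding a point x ∈ J ∖ K can only break the edge into x
-- (then prev x ∈ J ∖ K as well) or the edge out of x (then its successor is in J ∖ K).  If every
-- point of J ∖ K were blocked, the blocking would propagate all the way around the cycle in one
-- direction, so one pattern would be forbidden everywhere.  So some point can always be added.

open import Defs
open import Data.Nat using (ℕ; zero; suc; _+_; _*_; _∸_; _^_; _<_; z≤n; s≤s⁻¹; NonZero; nonTrivial⇒n>1)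
  renaming (_≤_ to _≤ℕ_)
open import Data.Nat.Properties
  using (+-suc; *-comm; m^n≢0; m≢1+n+m; <⇒≢; >⇒≢; <⇒≱; <-irrefl; <-≤-trans; ≰⇒>; m∸n≡0⇒m≤n; m∸n≤m; m∸n+n≡m; suc-pred; n<1⇒n≡0)
  renaming (_≟_ to _≟ℕ_)
open import Data.Nat.DivMod using (_/_; _%_; n/1≡n; m/n/o≡m/[n*o]; m<n*o⇒m/o<n; m≡m%n+[m/n]*n)
open import Data.Nat.Primality using (Prime; prime⇒nonZero; prime⇒nonTrivial)
open import Data.Bool using (Bool; true; false; not; _xor_) renaming (_≟_ to _≟𝔹_)
open import Data.Bool.Properties using (¬-not; xor-assoc; xor-identityʳ)
open import Data.Fin using (Fin; zero; suc; toℕ; fromℕ; inject₁; _≤_)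
open import Data.Fin.Properties using (_≟_; _≤?_; ≤fromℕ; ≤-antisym; toℕ-inject₁; fromℕ≢inject₁; inject₁-injective; any?; all?)
open import Data.Fin.Induction using (<-weakInduction; <-weakInduction-startingFrom; >-weakInduction)
open import Data.Fin.Subset using (Subset; inside; outside; _∈_; _∉_; _⊆_; _⊂_; ∣_∣; ⊥; ⁅_⁆)
open import Data.Fin.Subset.Properties using (p⊆q⇒∣p∣≤∣q∣; p⊂q⇒∣p∣<∣q∣; ⊆-antisym; _⊂?_; _∈?_)
open import Data.Vec using (_∷_; here; there; lookup; _[_]≔_)
open import Data.Vec.Properties using ([]=⇒lookup; lookup⇒[]=; lookup∘update; lookup∘update′; []≔-updates; []≔-minimal; lookup-zipWith; lookup-replicate)
open import Data.Product using (_×_; _,_; proj₁; proj₂; ∃-syntax)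
open import Data.Sum using (_⊎_; inj₁; inj₂; [_,_]; swap)
open import Data.Unit using (⊤; tt)
open import Data.Empty using (⊥-elim)
open import Function.Bundles using (_⇔_; mk⇔; Equivalence)
open import Relation.Nullary using (¬_; Dec; yes; no; contradiction; ¬?)
open import Relation.Nullary.Decidable using (_×-dec_; decidable-stable)
open import Relation.Unary using (Pred)
open import Relation.Binary.PropositionalEquality using (_≡_; _≢_; refl; sym; trans; cong; cong₂; subst; subst₂; module ≡-Reasoning)

open Equivalence using (to; from)

prev-injective : ∀ {m} {i j : Fin (suc m)} → prev i ≡ prev j → i ≡ j
prev-injective {i = zero}  {zero}  _ = refl
prev-injective {i = zero}  {suc _} e = ⊥-elim (fromℕ≢inject₁ e)
prev-injective {i = suc _} {zero}  e = ⊥-elim (fromℕ≢inject₁ (sym e))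
prev-injective {i = suc _} {suc _} e = cong suc (inject₁-injective e)

cyclicInduction⁺ : ∀ {m ℓ} (P : Pred (Fin (suc m)) ℓ) {x₀} → P x₀ →
  (∀ y → P (prev y) → P y) → ∀ j → P j
cyclicInduction⁺ P Px₀ step = <-weakInduction P (step zero P-top) (λ i → step (suc i))
  where P-top = <-weakInduction-startingFrom P Px₀ (λ i → step (suc i)) (≤fromℕ _)

cyclicInduction⁻ : ∀ {m ℓ} (P : Pred (Fin (suc m)) ℓ) {x₀} → P x₀ →
  (∀ y → P y → P (prev y)) → ∀ j → P j
cyclicInduction⁻ P {x₀} Px₀ step = >-weakInduction P (step zero (below zero z≤n)) (λ i → step (suc i))
  where
  below : ∀ j → j ≤ x₀ → P j
  below = >-weakInduction (λ j → j ≤ x₀ → P j)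
    (λ top≤x₀ → subst P (≤-antisym (≤fromℕ x₀) top≤x₀) Px₀)
    descend
    where
    descend : ∀ i → (suc i ≤ x₀ → P (suc i)) → inject₁ i ≤ x₀ → P (inject₁ i)
    descend i ih i≤x₀ with suc i ≤? x₀
    ... | yes 1+i≤x₀ = step (suc i) (ih 1+i≤x₀)
    ... | no  1+i≰x₀ = subst P (≤-antisym x₀≤i i≤x₀) Px₀
      where
      x₀≤i : x₀ ≤ inject₁ i
      x₀≤i = subst (toℕ x₀ ≤ℕ_) (sym (toℕ-inject₁ i)) (s≤s⁻¹ (≰⇒> 1+i≰x₀))

insert : ∀ {n} → Fin n → Subset n → Subset n
insert x p = p [ x ]≔ inside

record SaturatedChain {n ℓ} (V : Pred (Subset n) ℓ) (k : ℕ) (K J : Subset n) : Set ℓ where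
  field
    chain  : Fin (suc k) → Subset n
    start  : chain zero ≡ K
    end    : chain (fromℕ k) ≡ J
    strict : (i : Fin k) → chain (inject₁ i) ⊂ chain (suc i)
    card   : (i : Fin (suc k)) → ∣ chain i ∣ ≡ toℕ i + ∣ K ∣
    valid  : (i : Fin (suc k)) → V (chain i)

Augmentable : ∀ {n ℓ} → Pred (Subset n) ℓ → Set ℓ
Augmentable V = ∀ {K J} → V K → V J → K ⊂ J → ∃[ x ] x ∉ K × x ∈ J × V (insert x K)

augmentable-⇔ : ∀ {n ℓ ℓ′} {V : Pred (Subset n) ℓ} {W : Pred (Subset n) ℓ′} →
  (∀ K → V K ⇔ W K) → Augmentable W → Augmentable V
augmentable-⇔ V⇔W augW VK VJ K⊂J with augW (to (V⇔W _) VK) (to (V⇔W _) VJ) K⊂J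
... | x , x∉K , x∈J , Wx = x , x∉K , x∈J , from (V⇔W _) Wx

⊆⇒≡⊎⊂ : ∀ {n} {p q : Subset n} → p ⊆ q → p ≡ q ⊎ p ⊂ q
⊆⇒≡⊎⊂ {p = p} {q} p⊆q with p ⊂? q
... | yes p⊂q = inj₂ p⊂q
... | no  p⊄q = inj₁ (⊆-antisym p⊆q q⊆p)
  where
  q⊆p : q ⊆ p
  q⊆p {x} x∈q = decidable-stable (x ∈? p) (λ x∉p → p⊄q (p⊆q , x , x∈q , x∉p))

∣insert∣ : ∀ {n} {x : Fin n} (p : Subset n) → x ∉ p → ∣ insert x p ∣ ≡ suc ∣ p ∣
∣insert∣ {x = zero}  (outside ∷ p) _   = refl
∣insert∣ {x = zero}  (inside  ∷ p) x∉p = contradiction here x∉p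
∣insert∣ {x = suc x} (outside ∷ p) x∉p = ∣insert∣ p (λ x∈p → x∉p (there x∈p))
∣insert∣ {x = suc x} (inside  ∷ p) x∉p = cong suc (∣insert∣ p (λ x∈p → x∉p (there x∈p)))

∈insert⁺ : ∀ {n} {x y : Fin n} {p : Subset n} → y ∈ p → y ∈ insert x p
∈insert⁺ {x = x} {y} {p} y∈p with y ≟ x
... | yes refl = []≔-updates p x
... | no  y≢x  = []≔-minimal p y x y≢x y∈p

⊂insert : ∀ {n} {x : Fin n} {p : Subset n} → x ∉ p → p ⊂ insert x p
⊂insert {x = x} {p} x∉p = ∈insert⁺ , x , []≔-updates p x , x∉p

insert⊆ : ∀ {n} {x : Fin n} {p q : Subset n} → p ⊆ q → x ∈ q → insert x p ⊆ q
insert⊆ {x = x} {p} p⊆q x∈q {y} y∈p⁺ with y ≟ x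
... | yes refl = x∈q
... | no  y≢x  = p⊆q (lookup⇒[]= y p (trans (sym (lookup∘update′ y≢x p inside)) ([]=⇒lookup y∈p⁺)))

module _ {n ℓ} {V : Pred (Subset n) ℓ} where

  prependChain : ∀ {k K K′ J} → V K → K ⊂ K′ → ∣ K′ ∣ ≡ suc ∣ K ∣ →
    SaturatedChain V k K′ J → SaturatedChain V (suc k) K J
  prependChain {k} {K} {K′} VK K⊂K′ ∣K′∣ c = record
    { chain = chain′ ; start = refl ; end = end ; strict = strict′ ; card = card′ ; valid = valid′ }
    where
    open SaturatedChain c
    chain′ : Fin (suc (suc k)) → Subset n
    chain′ zero    = K
    chain′ (suc i) = chain i
    strict′ : (i : Fin (suc k)) → chain′ (inject₁ i) ⊂ chain′ (suc i)
    strict′ zero    = subst (K ⊂_) (sym start) K⊂K′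
    strict′ (suc i) = strict i
    card′ : (i : Fin (suc (suc k))) → ∣ chain′ i ∣ ≡ toℕ i + ∣ K ∣
    card′ zero    = refl
    card′ (suc i) = trans (card i) (trans (cong (toℕ i +_) ∣K′∣) (+-suc (toℕ i) ∣ K ∣))
    valid′ : (i : Fin (suc (suc k))) → V (chain′ i)
    valid′ zero    = VK
    valid′ (suc i) = valid i

  saturatedChain : Augmentable V → ∀ k {K J} → V K → V J → K ⊆ J → ∣ J ∣ ≡ k + ∣ K ∣ →
    SaturatedChain V k K J
  saturatedChain aug k VK VJ K⊆J ∣J∣ with ⊆⇒≡⊎⊂ K⊆J
  saturatedChain aug zero {K} VK _ _ _ | inj₁ refl = record
    { chain = λ _ → K ; start = refl ; end = refl ; strict = λ () ; card = λ { zero → refl } ; valid = λ _ → VK }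
  saturatedChain aug (suc k) {K} _ _ _ ∣J∣ | inj₁ refl = contradiction ∣J∣ (m≢1+n+m ∣ K ∣)
  saturatedChain aug zero _ _ _ ∣J∣ | inj₂ K⊂J = contradiction (sym ∣J∣) (<⇒≢ (p⊂q⇒∣p∣<∣q∣ K⊂J))
  saturatedChain aug (suc k) {K} VK VJ K⊆J ∣J∣ | inj₂ K⊂J with aug VK VJ K⊂J
  ... | x , x∉K , x∈J , VK⁺ =
    prependChain VK (⊂insert x∉K) (∣insert∣ K x∉K)
      (saturatedChain aug k VK⁺ VJ (insert⊆ K⊆J x∈J)
        (trans ∣J∣ (trans (sym (+-suc k ∣ K ∣)) (cong (k +_) (sym (∣insert∣ K x∉K))))))

Valid : ∀ {m} → (Fin (suc m) → Bool → Bool → Set) → Subset (suc m) → Set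
Valid Ok K = ∀ j → Ok j (lookup K j) (lookup K (prev j))

∉⇒lookup≡outside : ∀ {n} {x : Fin n} {p : Subset n} → x ∉ p → lookup p x ≡ outside
∉⇒lookup≡outside {x = x} {p} x∉p = ¬-not (λ e → x∉p (lookup⇒[]= x p e))

lookup≡outside⇒∉ : ∀ {n} {x : Fin n} {p : Subset n} → lookup p x ≡ outside → x ∉ p
lookup≡outside⇒∉ e x∈p with () ← trans (sym ([]=⇒lookup x∈p)) e

module _ {m} {Ok : Fin (suc m) → Bool → Bool → Set}
  (ok? : ∀ j a b → Dec (Ok j a b))
  (start-or-end-ok : ∀ j → Ok j true false ⊎ Ok j false true)
  (start-ok-somewhere : ¬ (∀ j → ¬ Ok j true false))
  (end-ok-somewhere : ¬ (∀ j → ¬ Ok j false true))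
  where

  private
    module Augment {K J : Subset (suc m)} (VK : Valid Ok K) (VJ : Valid Ok J)
      (K⊆J : ∀ j → lookup K j ≡ true → lookup J j ≡ true) where

      New : Fin (suc m) → Set
      New x = lookup K x ≡ false × lookup J x ≡ true

      differs⇒New : ∀ i → lookup K i ≢ lookup J i → New i
      differs⇒New i K≢J with lookup K i in eK | lookup J i in eJ
      ... | false | true  = refl , refl
      ... | false | false = contradiction refl K≢J
      ... | true  | true  = contradiction refl K≢J
      ... | true  | false with () ← trans (sym eJ) (K⊆J i eK)

      insert-valid : ∀ x → New x → Ok x true (lookup K (prev x)) →
        (∀ n → prev n ≡ x → Ok n (lookup K n) true) → Valid Ok (insert x K)
      insert-valid x (_ , Jx) okx okn j with j ≟ x | prev j ≟ x
      -- prev j ≡ j only on the one-point cycle, where insert x K is J.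
      ... | yes j≡x | yes pj≡x = subst₂ (Ok j) (at j≡x) (at pj≡x) (subst₂ (Ok j) (J-at j≡x) (J-at pj≡x) (VJ j))
        where
        J-at : ∀ {i} → i ≡ x → lookup J i ≡ true
        J-at refl = Jx
        at : ∀ {i} → i ≡ x → true ≡ lookup (insert x K) i
        at refl = sym (lookup∘update x K true)
      ... | yes refl | no pj≢x = subst₂ (Ok j) (sym (lookup∘update j K true)) (sym (lookup∘update′ pj≢x K true)) okx
      ... | no j≢x | yes refl = subst₂ (Ok j) (sym (lookup∘update′ j≢x K true)) (sym (lookup∘update (prev j) K true)) (okn j refl)
      ... | no j≢x | no pj≢x = subst₂ (Ok j) (sym (lookup∘update′ j≢x K true)) (sym (lookup∘update′ pj≢x K true)) (VK j)

      insertion-failure : ∀ x → New x → ¬ Valid Ok (insert x K) →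
        ¬ Ok x true (lookup K (prev x)) ⊎ ∃[ n ] prev n ≡ x × ¬ Ok n (lookup K n) true
      insertion-failure x new ¬valid with ok? x true (lookup K (prev x))
      ... | no ¬okx = inj₁ ¬okx
      ... | yes okx with any? (λ n → (prev n ≟ x) ×-dec ¬? (ok? n (lookup K n) true))
      ...   | yes failure = inj₂ failure
      ...   | no ∄failure = contradiction (insert-valid x new okx okn) ¬valid
        where
        okn : ∀ n → prev n ≡ x → Ok n (lookup K n) true
        okn n pn≡x = decidable-stable (ok? n _ true) (λ ¬okn → ∄failure (n , pn≡x , ¬okn))

      ¬blocked-start-and-end : ∀ j → ¬ (¬ Ok j true false × ¬ Ok j false true)
      ¬blocked-start-and-end j (¬start , ¬end) = [ ¬start , ¬end ] (start-or-end-ok j)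

      New-behind : ∀ x → New x → ¬ Ok x true (lookup K (prev x)) → New (prev x)
      New-behind x (_ , Jx) ¬okx = differs⇒New (prev x) (λ e → ¬okx (subst₂ (Ok x) Jx (sym e) (VJ x)))

      New-ahead : ∀ n → New (prev n) → ¬ Ok n (lookup K n) true → New n
      New-ahead n (_ , Jpn) ¬okn = differs⇒New n (λ e → ¬okn (subst₂ (Ok n) (sym e) Jpn (VJ n)))

      module Stuck (stuck : ∀ x → New x → ¬ Valid Ok (insert x K)) where

        BlockedBehind : Fin (suc m) → Set
        BlockedBehind x = New x × ¬ Ok x true (lookup K (prev x))

        BlockedAhead : Fin (suc m) → Set
        BlockedAhead n = New n × ¬ Ok n false true

        blockedAhead : ∀ n → New (prev n) → ¬ Ok n (lookup K n) true → BlockedAhead n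
        blockedAhead n new ¬okn = newⁿ , subst (λ b → ¬ Ok n b true) (proj₁ newⁿ) ¬okn
          where newⁿ = New-ahead n new ¬okn

        blockedBehind⇒¬start-ok : ∀ x → BlockedBehind x → ¬ Ok x true false
        blockedBehind⇒¬start-ok x (new , ¬okx) = subst (λ b → ¬ Ok x true b) (proj₁ (New-behind x new ¬okx)) ¬okx

        blockedBehind-prev : ∀ x → BlockedBehind x → BlockedBehind (prev x)
        blockedBehind-prev x (new , ¬okx) with insertion-failure (prev x) newᵖ (stuck (prev x) newᵖ)
          where newᵖ = New-behind x new ¬okx
        ... | inj₁ ¬okᵖ = New-behind x new ¬okx , ¬okᵖ
        ... | inj₂ (n , pn≡px , ¬okn) with refl ← prev-injective {i = n} {x} pn≡px =
          ⊥-elim (¬blocked-start-and-end x (blockedBehind⇒¬start-ok x (new , ¬okx) , subst (λ b → ¬ Ok x b true) (proj₁ new) ¬okn))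

        blockedAhead-next : ∀ n → BlockedAhead (prev n) → BlockedAhead n
        blockedAhead-next n (new , ¬down) with insertion-failure (prev n) new (stuck (prev n) new)
        ... | inj₁ ¬okᵖ = ⊥-elim (¬blocked-start-and-end (prev n) (blockedBehind⇒¬start-ok (prev n) (new , ¬okᵖ) , ¬down))
        ... | inj₂ (n′ , pn′≡pn , ¬okn) with refl ← prev-injective {i = n′} {n} pn′≡pn = blockedAhead n new ¬okn

        absurd : ∀ x → ¬ New x
        absurd x new with insertion-failure x new (stuck x new)
        ... | inj₁ ¬okx = start-ok-somewhere λ j →
          blockedBehind⇒¬start-ok j (cyclicInduction⁻ BlockedBehind (new , ¬okx) blockedBehind-prev j)
        ... | inj₂ (n , refl , ¬okn) = end-ok-somewhere λ j →
          proj₂ (cyclicInduction⁺ BlockedAhead (blockedAhead n new ¬okn) blockedAhead-next j)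

      augment : ∀ x → New x → ∃[ y ] New y × Valid Ok (insert y K)
      augment x new with any? (λ y → ((lookup K y ≟𝔹 false) ×-dec (lookup J y ≟𝔹 true)) ×-dec all? (λ j → ok? j _ _))
      ... | yes (y , newʸ , valid) = y , newʸ , valid
      ... | no ∄ = ⊥-elim (Stuck.absurd (λ y newʸ valid → ∄ (y , newʸ , valid)) x new)

  valid-augmentable : Augmentable (Valid Ok)
  valid-augmentable {K} {J} VK VJ (K⊆J , x , x∈J , x∉K)
    with Augment.augment {K} {J} VK VJ (λ j e → []=⇒lookup (K⊆J (lookup⇒[]= j K e))) x (∉⇒lookup≡outside x∉K , []=⇒lookup x∈J)
  ... | y , (Ky , Jy) , valid = y , lookup≡outside⇒∉ Ky , lookup⇒[]= y J Jy , valid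

module _ {p : ℕ} (pp : Prime p) where

  private instance
    p≢0 : NonZero p
    p≢0 = prime⇒nonZero pp

  p∸1≢0 : p ∸ 1 ≢ 0
  p∸1≢0 e = <⇒≱ (nonTrivial⇒n>1 p {{prime⇒nonTrivial pp}}) (m∸n≡0⇒m≤n e)

  digit-zero : ∀ c → digit p pp c 0 ≡ c % p
  digit-zero c = cong (_% p) (n/1≡n c)

  digit-suc : ∀ c j → digit p pp c (suc j) ≡ digit p pp (c / p) j
  digit-suc c j = cong (_% p) (sym (m/n/o≡m/[n*o] c p (p ^ j) {{_}} {{m^n≢0 p j}} {{m^n≢0 p (suc j)}}))

  private
    /p< : ∀ {n c} → c < p ^ suc n → c / p < p ^ n
    /p< {n} {c} c< = m<n*o⇒m/o<n (subst (c <_) (*-comm p (p ^ n)) c<)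

  digits≡0⇒≡0 : ∀ n {c} → c < p ^ n → (∀ (j : Fin n) → digit p pp c (toℕ j) ≡ 0) → c ≡ 0
  digits≡0⇒≡0 zero    c<1 _ = n<1⇒n≡0 c<1
  digits≡0⇒≡0 (suc n) {c} c< dig = begin
    c                   ≡⟨ m≡m%n+[m/n]*n c p ⟩
    c % p + (c / p) * p ≡⟨ cong₂ (λ a b → a + b * p) (trans (sym (digit-zero c)) (dig zero))
                                (digits≡0⇒≡0 n (/p< {n} c<) (λ j → trans (sym (digit-suc c (toℕ j))) (dig (suc j)))) ⟩
    0                   ∎
    where open ≡-Reasoning

  digits≡p∸1⇒suc≡p^n : ∀ n {c} → c < p ^ n → (∀ (j : Fin n) → digit p pp c (toℕ j) ≡ p ∸ 1) → suc c ≡ p ^ n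
  digits≡p∸1⇒suc≡p^n zero    c<1 _ = cong suc (n<1⇒n≡0 c<1)
  digits≡p∸1⇒suc≡p^n (suc n) {c} c< dig = begin
    suc c                       ≡⟨ cong suc (m≡m%n+[m/n]*n c p) ⟩
    suc (c % p + (c / p) * p)   ≡⟨ cong (λ a → suc (a + (c / p) * p)) (trans (sym (digit-zero c)) (dig zero)) ⟩
    suc (p ∸ 1 + (c / p) * p)   ≡⟨ cong (_+ (c / p) * p) (suc-pred p) ⟩
    suc (c / p) * p             ≡⟨ cong (_* p) (digits≡p∸1⇒suc≡p^n n (/p< {n} c<)
                                     (λ j → trans (sym (digit-suc c (toℕ j))) (dig (suc j)))) ⟩
    p ^ n * p                   ≡⟨ *-comm (p ^ n) p ⟩
    p ^ suc n                   ∎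
    where open ≡-Reasoning

BoundaryOk : ℕ → ℕ → Bool → Bool → Set
BoundaryOk p d true  false = d ≢ p ∸ 1
BoundaryOk p d false true  = d ≢ 0
BoundaryOk p d true  true  = ⊤
BoundaryOk p d false false = ⊤

boundaryOk? : ∀ p d u v → Dec (BoundaryOk p d u v)
boundaryOk? p d true  false = ¬? (d ≟ℕ p ∸ 1)
boundaryOk? p d false true  = ¬? (d ≟ℕ 0)
boundaryOk? p d true  true  = yes tt
boundaryOk? p d false false = yes tt

≢p∸1⊎≢0 : ∀ p → p ∸ 1 ≢ 0 → ∀ d → d ≢ p ∸ 1 ⊎ d ≢ 0
≢p∸1⊎≢0 p p∸1≢0 d with d ≟ℕ 0
... | yes refl = inj₁ (λ 0≡p∸1 → p∸1≢0 (sym 0≡p∸1))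
... | no  d≢0  = inj₂ d≢0

boundaryOk-flip : ∀ p → p ∸ 1 ≢ 0 → ∀ d u v → BoundaryOk p d (not u) v ⊎ BoundaryOk p d u (not v)
boundaryOk-flip p _ d true  false = inj₁ tt
boundaryOk-flip p _ d false true  = inj₁ tt
boundaryOk-flip p p∸1≢0 d true  true  = swap (≢p∸1⊎≢0 p p∸1≢0 d)
boundaryOk-flip p p∸1≢0 d false false = ≢p∸1⊎≢0 p p∸1≢0 d

boundaryOk-regular : ∀ p {d} → 0 < d → d < p ∸ 1 → ∀ u v → BoundaryOk p d u v
boundaryOk-regular p _   d<p∸1 true  false = <⇒≢ d<p∸1
boundaryOk-regular p 0<d _     false true  = >⇒≢ 0<d
boundaryOk-regular p _   _     true  true  = tt
boundaryOk-regular p _   _     false false = tt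

BoundaryOk∈ : ∀ {n} → ℕ → ℕ → Subset n → Subset n → Fin n → Fin n → Set
BoundaryOk∈ p d L M i i′ = (i ∈ L → i′ ∉ M → d ≢ p ∸ 1) × (i ∉ L → i′ ∈ M → d ≢ 0)

boundaryOk∈⇔boundaryOk : ∀ {n p d} (L M : Subset n) i i′ →
  BoundaryOk∈ p d L M i i′ ⇔ BoundaryOk p d (lookup L i) (lookup M i′)
boundaryOk∈⇔boundaryOk L M i i′ with lookup L i in eL | lookup M i′ in eM
... | true  | false = mk⇔ (λ (ok , _) → ok i∈L (lookup≡outside⇒∉ eM))
                          (λ d≢ → (λ _ _ → d≢) , contradiction i∈L)
  where i∈L = lookup⇒[]= i L eL
... | false | true  = mk⇔ (λ (_ , ok) → ok (lookup≡outside⇒∉ eL) (lookup⇒[]= i′ M eM))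
                          (λ d≢ → (λ i∈L → contradiction i∈L (lookup≡outside⇒∉ eL)) , (λ _ _ → d≢))
... | true  | true  = mk⇔ (λ _ → tt)
                          (λ _ → (λ _ → contradiction (lookup⇒[]= i′ M eM)) , contradiction (lookup⇒[]= i L eL))
... | false | false = mk⇔ (λ _ → tt)
                          (λ _ → (λ i∈L → contradiction i∈L (lookup≡outside⇒∉ eL)) ,
                                 (λ _ i′∈M → contradiction i′∈M (lookup≡outside⇒∉ eM)))

pointwise-⇔ : ∀ {n} {A B : Fin n → Set} → (∀ j → A j ⇔ B j) → (∀ j → A j) ⇔ (∀ j → B j)
pointwise-⇔ A⇔B = mk⇔ (λ A j → to (A⇔B j) (A j)) (λ B j → from (A⇔B j) (B j))

lookup-△ : ∀ {n} (K A : Subset n) i → lookup (K △ A) i ≡ lookup K i xor lookup A i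
lookup-△ K A i = lookup-zipWith _xor_ i K A

lookup-△⊥ : ∀ {n} (K : Subset n) i → lookup (K △ ⊥) i ≡ lookup K i
lookup-△⊥ K i = trans (lookup-△ K ⊥ i) (trans (cong (lookup K i xor_) (lookup-replicate i false)) (xor-identityʳ _))

lookup-△△ : ∀ {n} (K A B : Subset n) i → lookup ((K △ A) △ B) i ≡ lookup K i xor lookup (A △ B) i
lookup-△△ K A B i = begin
  lookup ((K △ A) △ B) i                       ≡⟨ lookup-△ (K △ A) B i ⟩
  lookup (K △ A) i xor lookup B i              ≡⟨ cong (_xor lookup B i) (lookup-△ K A i) ⟩
  (lookup K i xor lookup A i) xor lookup B i   ≡⟨ xor-assoc (lookup K i) _ _ ⟩
  lookup K i xor (lookup A i xor lookup B i)   ≡⟨ cong (lookup K i xor_) (sym (lookup-△ A B i)) ⟩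
  lookup K i xor lookup (A △ B) i              ∎
  where open ≡-Reasoning

module _ {p : ℕ} {pp : Prime p} {m : ℕ} where

  -- Okτ τ j [j ∈ K] [prev j ∈ K] is the condition at j for ι τ K ∈ P_τ; the xors pass from K to
  -- ι(K) = K △ J_base and, for cuspidal types, to J₀ = ι(K) △ {f-1}.
  Okτ : TameType p pp m → Fin (suc m) → Bool → Bool → Set
  Okτ (principal c _ _) j a b = BoundaryOk p (digit p pp c (toℕ j)) a b
  Okτ (cuspidal _ c _ _ _ i _ _) j a b =
    BoundaryOk p (digit p pp c (toℕ j)) (a xor lookup (upFrom i) j) (b xor lookup (upFrom i △ ⁅ top m ⁆) (prev j))

  Pτ∘ι⇔Valid : ∀ τ K → Pτ τ (ι τ K) ⇔ Valid (Okτ τ) K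
  Pτ∘ι⇔Valid (principal c _ _) K = pointwise-⇔ λ j →
    subst₂ (λ u v → BoundaryOk∈ p (digit p pp c (toℕ j)) (K △ ⊥) (K △ ⊥) j (prev j) ⇔ BoundaryOk p _ u v)
      (lookup-△⊥ K j) (lookup-△⊥ K (prev j)) (boundaryOk∈⇔boundaryOk (K △ ⊥) (K △ ⊥) j (prev j))
  Pτ∘ι⇔Valid (cuspidal _ c _ _ _ i _ _) K = pointwise-⇔ λ j →
    subst₂ (λ u v → BoundaryOk∈ p (digit p pp c (toℕ j)) L (L △ T) j (prev j) ⇔ BoundaryOk p _ u v)
      (lookup-△ K B j) (lookup-△△ K B T (prev j)) (boundaryOk∈⇔boundaryOk L (L △ T) j (prev j))
    where
    B = upFrom i
    T = ⁅ top m ⁆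
    L = K △ B

  okτ? : ∀ τ j a b → Dec (Okτ τ j a b)
  okτ? (principal c _ _)          j a b = boundaryOk? p _ a b
  okτ? (cuspidal _ c _ _ _ i _ _) j a b = boundaryOk? p _ _ _

  okτ-start-or-end : ∀ τ j → Okτ τ j true false ⊎ Okτ τ j false true
  okτ-start-or-end (principal c _ _)          j = boundaryOk-flip p (p∸1≢0 pp) _ false false
  okτ-start-or-end (cuspidal _ c _ _ _ i _ _) j =
    boundaryOk-flip p (p∸1≢0 pp) _ (lookup (upFrom i) j) (lookup (upFrom i △ ⁅ top m ⁆) (prev j))

  okτ-start-somewhere : ∀ τ → ¬ (∀ j → ¬ Okτ τ j true false)
  okτ-start-somewhere (principal c _ c<q∸1) ¬ok = <-irrefl (cong (_∸ 1) all-top) c<q∸1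
    where
    all-top : suc c ≡ q p m
    all-top = digits≡p∸1⇒suc≡p^n pp (suc m) (<-≤-trans c<q∸1 (m∸n≤m _ 1))
                (λ j → decidable-stable (_ ≟ℕ p ∸ 1) (¬ok j))
  okτ-start-somewhere (cuspidal _ _ _ _ (i₀ , 0<d , d<p∸1) _ _ _) ¬ok = ¬ok i₀ (boundaryOk-regular p 0<d d<p∸1 _ _)

  okτ-end-somewhere : ∀ τ → ¬ (∀ j → ¬ Okτ τ j false true)
  okτ-end-somewhere (principal c 0<c c<q∸1) ¬ok = >⇒≢ 0<c all-zero
    where
    all-zero : c ≡ 0
    all-zero = digits≡0⇒≡0 pp (suc m) (<-≤-trans c<q∸1 (m∸n≤m _ 1)) (λ j → decidable-stable (_ ≟ℕ 0) (¬ok j))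
  okτ-end-somewhere (cuspidal _ _ _ _ (i₀ , 0<d , d<p∸1) _ _ _) ¬ok = ¬ok i₀ (boundaryOk-regular p 0<d d<p∸1 _ _)

  Pτ∘ι-augmentable : ∀ τ → Augmentable (λ K → Pτ τ (ι τ K))
  Pτ∘ι-augmentable τ = augmentable-⇔ (Pτ∘ι⇔Valid τ)
    (valid-augmentable (okτ? τ) (okτ-start-or-end τ) (okτ-start-somewhere τ) (okτ-end-somewhere τ))

lemma5p2p1 : (p : ℕ) (pp : Prime p) (m : ℕ) (τ : TameType p pp m)
    (J J' : Subset (suc m)) → J ⊆ J' →
    Pτ τ (ι τ J) → Pτ τ (ι τ J') → Chain τ J J'
lemma5p2p1 p pp m τ J J' J⊆J' PJ PJ' = record
  { chain = chain ; start = start ; end = end ; strict = strict ; card = card ; inP = valid }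
  where
  open SaturatedChain (saturatedChain (Pτ∘ι-augmentable τ) (∣ J' ∣ ∸ ∣ J ∣) PJ PJ' J⊆J'
    (sym (m∸n+n≡m (p⊆q⇒∣p∣≤∣q∣ J⊆J'))))
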